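{- Let $g\geq 2$ and let $\pi\colon G\to H$ be an object of $\mathbb{AC}_g$ of top dimension such that $\mathrm{ft}_G\circ F_\pi$ is invertible. If $V$ is a vertex of $H$ with $\mathrm{legval}(V)=2$, then one of the following holds: (i) the fiber $\pi^{ -1}(V)$ is a single vertex of local degree $g$, and $V$ is incident to $\ell_1(H)$; (ii) there is a unique vertex $\hat V\in\pi^{ -1}(V)$ with $d_\pi(\hat V)=2$, all other vertices of $\pi^{ -1}(V)$ have local degree $1$, and $V$ is incident to legs whose ramification profiles are $(2,1^{g-2})$.
   Context: Graphs have vertices, edges (loops allowed) and legs (half-edges at one vertex); $\mathrm{val}(V)$ counts edge-ends and legs at $V$, $\mathrm{legval}(V)$ counts legs at $V$. $\mathbb{G}_{h,m}$: connected genus-$h$ graphs with all vertices of valency $\geq3$ and $m$ legs labelled $\ell_1,\dots,\ell_m$. A discrete admissible cover $\pi\colon G\to H$ is a surjective map sending vertices to vertices, edges to edges, legs to legs compatibly with incidence, with $d_\pi\geq0$ on vertices, edges and legs such that for each $V\in V(G)$ and each edge-end or leg $h'$ at $\pi(V)$, $d_\pi(V)=\sum d_\pi(h)$ over edge-ends/legs $h$ at $V$ over $h'$, and $\mathrm{val}(V)-2=d_\pi(V)(\mathrm{val}(\pi(V))-2)$; $d_\pi(V)$ is the local degree. The ramification profile over an edge/leg $h'$ of $H$ is the partition $(d_\pi(e))_{e\in\pi^{ -1}(h')}$. With $n=1+(3g-1)(g-1)$, $\mathbb{AC}_g$ is the set of degree-$g$ discrete admissible covers $\pi\colon G\to H$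 with $H\in\mathbb{G}_{0,3g}$, $G\in\mathbb{G}_{g,n}$, ramification profile $(g)$ over $\ell_1(H)$ (with $\pi^{ -1}(\ell_1(H))=\{\ell_1(G)\}$) and $(2,1^{g-2})$ over $\ell_k(H)$ for $2\leq k\leq3g$, the legs of $G$ over $\ell_k(H)$ being labelled consecutively in the order of $k$. $\pi$ is of top dimension if all vertices of $H$ are $3$-valent. $F_\pi\colon\mathbb{R}^{E(H)}\to\mathbb{R}^{E(G)}$, $(F_\pi v)_e=\frac{\mathrm{lcm}(d_\pi(e'))_{e'\in\pi^{ -1}(\pi(e))}}{d_\pi(e)}v_{\pi(e)}$. $\mathrm{st}(G)$ is obtained from $G$ by deleting legs, repeatedly removing $1$-valent vertices with their edge, and erasing $2$-valent vertices; each edge of $\mathrm{st}(G)$ is a path of edges of $G$, and $\mathrm{ft}_G\colon\mathbb{R}^{E(G)}\to\mathbb{R}^{E(\mathrm{st}(G))}$ sums coordinates along these paths. -}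

module Defs where

open import Data.Nat using (ℕ; zero; suc; _+_; _*_; _∸_; _≤_; _/_)
open import Data.Nat.LCM using (lcm)
import Data.Bool
open import Data.Bool using (Bool; true; false; if_then_else_; _∧_; not; _xor_)
open import Data.Fin using (Fin; zero; suc; toℕ; _≟_)
open import Data.List using (List; []; _∷_; map; filterᵇ; allFin; foldr; replicate)
open import Data.List.Relation.Binary.Permutation.Propositional using (_↭_)
open import Data.Maybe using (Maybe; just; nothing)
open import Data.Product using (Σ; ∃; _×_; _,_)
open import Data.Sum using (_⊎_)
open import Data.Integer as ℤ using (ℤ; +_)
open import Data.Rational as ℚ using (ℚ; 0ℚ; 1ℚ)
open import Relation.Nullary using (does; ¬_)
open import Relation.Binary.PropositionalEquality using (_≡_; _≢_)
open import Relation.Binary.Construct.Closure.ReflexiveTransitive using (Star)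
open import Function.Bundles using (_⇔_)

sumF : ∀ {n} → (Fin n → ℕ) → ℕ
sumF {zero}  f = 0
sumF {suc n} f = f zero + sumF (λ i → f (suc i))

sumB : (Bool → ℕ) → ℕ
sumB f = f false + f true

sumQ : ∀ {n} → (Fin n → ℚ) → ℚ
sumQ {zero}  f = 0ℚ
sumQ {suc n} f = f zero ℚ.+ sumQ (λ i → f (suc i))

ind : Bool → ℕ
ind b = if b then 1 else 0

eqF : ∀ {n} → Fin n → Fin n → Bool
eqF i j = does (i ≟ j)

eqB : Bool → Bool → Bool
eqB a b = does (a Data.Bool.≟ b)

-- Graphs with m labelled legs: leg  i : Fin m  is the leg ℓ_{toℕ i + 1}.
-- Edge e has two edge-ends (e , false) and (e , true) at  ends e false,
-- ends e true  (loops allowed: both ends at the same vertex).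

record Graph (m : ℕ) : Set where
  field
    nV    : ℕ
    nE    : ℕ
    ends  : Fin nE → Bool → Fin nV
    legAt : Fin m → Fin nV
open Graph public

legval : ∀ {m} (G : Graph m) → Fin (nV G) → ℕ
legval G v = sumF (λ l → ind (eqF (legAt G l) v))

edgeval : ∀ {m} (G : Graph m) → Fin (nV G) → ℕ
edgeval G v = sumF (λ e → sumB (λ b → ind (eqF (ends G e b) v)))

val : ∀ {m} (G : Graph m) → Fin (nV G) → ℕ
val G v = edgeval G v + legval G v

Adj : ∀ {m} (G : Graph m) → Fin (nV G) → Fin (nV G) → Set
Adj G u v = Σ (Fin (nE G)) λ e → Σ Bool λ b → (ends G e b ≡ u) × (ends G e (not b) ≡ v)

Connected : ∀ {m} (G : Graph m) → Set
Connected G = ∀ u v → Star (Adj G) u v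

-- G ∈ 𝔾_{h,m}: connected, genus h (first Betti number |E|-|V|+1 = h),
-- every vertex of valency ≥ 3
InGraphs : ∀ {m} (h : ℕ) (G : Graph m) → Set
InGraphs h G = Connected G × (nE G + 1 ≡ h + nV G) × (∀ v → 3 ≤ val G v)

record Cover {m m' : ℕ} (G : Graph m) (H : Graph m') : Set where
  field
    πV   : Fin (nV G) → Fin (nV H)
    πE   : Fin (nE G) → Fin (nE H)
    πL   : Fin m → Fin m'
    -- edge-end (e , b) of G is sent to edge-end (πE e , b xor flip e) of H
    flip : Fin (nE G) → Bool
    dV   : Fin (nV G) → ℕ
    dE   : Fin (nE G) → ℕ
    dL   : Fin m → ℕ
    surjV : ∀ v → ∃ λ w → πV w ≡ v
    surjE : ∀ e → ∃ λ f → πE f ≡ e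
    surjL : ∀ l → ∃ λ k → πL k ≡ l
    inc-E : ∀ e b → ends H (πE e) (b xor flip e) ≡ πV (ends G e b)
    inc-L : ∀ l → legAt H (πL l) ≡ πV (legAt G l)
    harm-E : ∀ v e' b' → ends H e' b' ≡ πV v →
      dV v ≡ sumF (λ e → sumB (λ b →
        if eqF (ends G e b) v ∧ eqF (πE e) e' ∧ eqB (b xor flip e) b'
        then dE e else 0))
    harm-L : ∀ v l' → legAt H l' ≡ πV v →
      dV v ≡ sumF (λ l → if eqF (legAt G l) v ∧ eqF (πL l) l' then dL l else 0)
    riemann-hurwitz : ∀ v →
      (+ val G v) ℤ.- (+ 2) ≡ (+ dV v) ℤ.* ((+ val H (πV v)) ℤ.- (+ 2))
open Cover public

module _ {m m' : ℕ} {G : Graph m} {H : Graph m'} (π : Cover G H) where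

  -- ramification profile over a leg / an edge of H (as a list; compared up to ↭)
  legProfile : Fin m' → List ℕ
  legProfile l' = map (dL π) (filterᵇ (λ l → eqF (πL π l) l') (allFin m))

  edgeProfile : Fin (nE H) → List ℕ
  edgeProfile e' = map (dE π) (filterᵇ (λ e → eqF (πE π e) e') (allFin (nE G)))

  HasDegree : ℕ → Set
  HasDegree g = (∀ e' → sumF (λ e → if eqF (πE π e) e' then dE π e else 0) ≡ g)
              × (∀ l' → sumF (λ l → if eqF (πL π l) l' then dL π l else 0) ≡ g)

nLegs : ℕ → ℕ
nLegs g = suc ((3 * g ∸ 1) * (g ∸ 1))

-- index (0-based) of the leg of H lying under the 0-based leg j of G,
-- for the labelling "consecutively in the order of k" (blocks of size g-1)
block : ℕ → ℕ → ℕ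
block g zero = 0
block (suc (suc h)) (suc j) = suc (j / suc h)
block _ (suc j) = 0

InAC : (g : ℕ) {G : Graph (nLegs g)} {H : Graph (3 * g)} → Cover G H → Set
InAC g {G} {H} π =
    InGraphs 0 H
  × InGraphs g G
  × HasDegree π g
  × (∀ l → toℕ (πL π l) ≡ block g (toℕ l))
  × (∀ l' → toℕ l' ≡ 0 → legProfile π l' ↭ (g ∷ []))
  × (∀ l' → toℕ l' ≢ 0 → legProfile π l' ↭ (2 ∷ replicate (g ∸ 2) 1))

TopDimension : ∀ {m} (H : Graph m) → Set
TopDimension H = ∀ v → val H v ≡ 3

Mat : ℕ → ℕ → Set
Mat r c = Fin r → Fin c → ℚ

_⊗_ : ∀ {r k c} → Mat r k → Mat k c → Mat r c
(A ⊗ B) i j = sumQ (λ t → A i t ℚ.* B t j)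

idMat : ∀ {n} → Mat n n
idMat i j = if eqF i j then 1ℚ else 0ℚ

Invertible : ∀ {r c} → Mat r c → Set
Invertible {r} {c} A = Σ (Mat c r) λ B →
  (∀ i j → (A ⊗ B) i j ≡ idMat i j) × (∀ i j → (B ⊗ A) i j ≡ idMat i j)

-- a / d as a rational (d = 0 never occurs for the covers considered; 0 by convention)
frac : ℕ → ℕ → ℚ
frac a zero    = 0ℚ
frac a (suc d) = (+ a) ℚ./ suc d

Fmat : ∀ {m m'} {G : Graph m} {H : Graph m'} → Cover G H → Mat (nE G) (nE H)
Fmat π e e' =
  if eqF (πE π e) e'
  then frac (foldr lcm 1 (edgeProfile π e')) (dE π e)
  else 0ℚ

module _ {m : ℕ} (G : Graph m) where

  aliveVal : (Fin (nE G) → Bool) → Fin (nV G) → ℕ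
  aliveVal alive v = sumF (λ e → sumB (λ b → ind (alive e ∧ eqF (ends G e b) v)))

  isOne : ℕ → Bool
  isOne 1 = true
  isOne _ = false

  pruneStep : (Fin (nE G) → Bool) → (Fin (nE G) → Bool)
  pruneStep alive e = alive e
    ∧ not (isOne (aliveVal alive (ends G e false)))
    ∧ not (isOne (aliveVal alive (ends G e true)))

  iter : ℕ → (Fin (nE G) → Bool) → (Fin (nE G) → Bool)
  iter zero    a = a
  iter (suc k) a = iter k (pruneStep a)

  -- edges surviving after deleting legs and repeatedly removing 1-valent
  -- vertices with their edge (nE rounds suffice to reach the fixed point)
  core : Fin (nE G) → Bool
  core = iter (nE G) (λ _ → true)

  LinkStep : Fin (nE G) → Fin (nE G) → Set
  LinkStep e e' = (core e ≡ true) × (core e' ≡ true) ×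
    Σ Bool λ b → Σ Bool λ b' → (ends G e b ≡ ends G e' b')
                               × (aliveVal core (ends G e b) ≡ 2)

  -- edges of G lying on the same path, after erasing 2-valent vertices
  Linked : Fin (nE G) → Fin (nE G) → Set
  Linked = Star LinkStep

  -- an enumeration of E(st(G)): cls e = just f iff e lies on the path of edge f
  record Stabilization : Set where
    field
      k        : ℕ
      cls      : Fin (nE G) → Maybe (Fin k)
      cls-core : ∀ e → core e ≡ true → ∃ λ f → cls e ≡ just f
      cls-non  : ∀ e → core e ≡ false → cls e ≡ nothing
      cls-surj : ∀ f → ∃ λ e → cls e ≡ just f
      cls-same : ∀ e e' f → cls e ≡ just f → (cls e' ≡ just f ⇔ Linked e e')
  open Stabilization public

  ftEntry : ∀ {k} → Fin k → Maybe (Fin k) → ℚ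
  ftEntry f (just f') = if eqF f f' then 1ℚ else 0ℚ
  ftEntry f nothing   = 0ℚ

  ftMat : (S : Stabilization) → Mat (k S) (nE G)
  ftMat S f e = ftEntry f (cls S e)

{-# OPTIONS --safe #-}
module Submission where

-- Since H is of top dimension and V carries two legs, V has exactly one edge-end, and every
-- vertex W over V has positive local degree d(W) = val W − 2.
-- If ℓ₁(H) is at V, the block labelling puts only ℓ₁(G) over it, so harmonicity at ℓ₁(H) makes
-- ℓ₁(G) lie at every vertex over V, and its local degree is the full degree g.
-- Otherwise both legs a, c at V are simple branch legs. At W over V, harmonicity at x ∈ {a, c}
-- gives d(W) = legCount W x + excess W x, where excess W x ≤ 1 counts the ramified leg over x,
-- and Riemann–Hurwitz gives edgeval W + legCount W a + legCount W c = d(W) + 2.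
-- Invertibility of ft_G ∘ F_π forces an edge of st(G) over the edge at V; its end W over V is not
-- pruned, so edgeval W ≥ 2, and the two identities force d(W) = 2 and both excesses at W to be 1.
-- All other vertices over V then have no excess, and the same identities give local degree 1.

open import Defs
open import Algebra.Properties.CommutativeSemigroup using (interchange)
open import Data.Bool using (Bool; true; false; not; _∧_; _xor_; if_then_else_; T)
import Data.Bool as Bool
open import Data.Bool.Properties using (∧-zeroʳ; ¬-not; xor-assoc; xor-same; xor-identityʳ)
open import Data.Empty using (⊥-elim)
open import Data.Fin using (Fin; zero; suc; toℕ; _≟_)
open import Data.Fin.Properties using (toℕ-injective; suc-injective; any?)
open import Data.List using (_∷_; map; filterᵇ; allFin; tabulate; replicate; foldr)
open import Data.Nat.LCM using (lcm)
open import Data.List.Membership.Propositional using (_∈_)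
open import Data.List.Membership.Propositional.Properties using (∈-map⁺; ∈-filter⁺; ∈-allFin)
open import Data.List.Properties using (map-∘)
open import Data.List.Relation.Binary.Permutation.Propositional using (_↭_)
open import Data.List.Relation.Binary.Permutation.Propositional.Properties using (∈-resp-↭; map⁺)
open import Data.List.Relation.Unary.All using (All; _∷_; lookup)
open import Data.List.Relation.Unary.All.Properties using (replicate⁺)
open import Data.Nat using (ℕ; zero; suc; _+_; _*_; _∸_; _≤_; _<_; z≤n; s≤s)
import Data.Nat as ℕ
open import Data.Nat.ListAction using (sum)
open import Data.Nat.ListAction.Properties using (sum-↭)
open import Data.Nat.Properties
  using (≤-refl; ≤-trans; ≤-antisym; ≤-reflexive; ≤-pred; ≤∧≢⇒<; n<1⇒n≡0; m≤m+n; m≤n+m;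
         +-identityʳ; +-mono-≤; +-monoˡ-≤; +-cancelˡ-≤; +-cancelʳ-≤; +-cancelʳ-≡; ∸-monoˡ-≤;
         m+[n∸m]≡n; +-commutativeSemigroup; module ≤-Reasoning)
open import Data.Product using (Σ; ∃; ∃₂; _×_; _,_; proj₁; proj₂)
open import Data.Rational using (0ℚ; 1ℚ)
import Data.Rational as ℚ
import Data.Rational.Properties as ℚ
import Data.Integer as ℤ
import Data.Integer.Properties as ℤ
open import Data.Sum using (_⊎_; inj₁; inj₂)
import Data.Sum as Sum
open import Function using (_∘_; id)
open import Relation.Binary.PropositionalEquality
  using (_≡_; _≢_; refl; sym; trans; cong; cong₂; subst; ≢-sym; module ≡-Reasoning)
open import Relation.Nullary using (¬_; yes; no)
open import Relation.Nullary.Decidable using (dec-true; dec-false; _×-dec_)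

eqF⇒≡ : ∀ {n} {i j : Fin n} → eqF i j ≡ true → i ≡ j
eqF⇒≡ {i = i} {j} with i ≟ j
... | yes i≡j = λ _ → i≡j
... | no _    = λ ()

≡⇒eqF : ∀ {n} {i j : Fin n} → i ≡ j → eqF i j ≡ true
≡⇒eqF {i = i} {j} = dec-true (i ≟ j)

≢⇒eqF : ∀ {n} {i j : Fin n} → i ≢ j → eqF i j ≡ false
≢⇒eqF {i = i} {j} = dec-false (i ≟ j)

false≢true : false ≢ true
false≢true ()

∧-true : ∀ {x y} → x ∧ y ≡ true → x ≡ true × y ≡ true
∧-true {true} {true} _ = refl , refl

if-pos⇒true : ∀ {b x} → 0 < (if b then x else 0) → b ≡ true
if-pos⇒true {true} _ = refl

sumF-cong : ∀ {n} {f g : Fin n → ℕ} → (∀ i → f i ≡ g i) → sumF f ≡ sumF g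
sumF-cong {zero}  f≗g = refl
sumF-cong {suc n} f≗g = cong₂ _+_ (f≗g zero) (sumF-cong (f≗g ∘ suc))

sumF-+ : ∀ {n} (f g : Fin n → ℕ) → sumF (λ i → f i + g i) ≡ sumF f + sumF g
sumF-+ {zero}  f g = refl
sumF-+ {suc n} f g = trans (cong ((f zero + g zero) +_) (sumF-+ (f ∘ suc) (g ∘ suc)))
                           (interchange +-commutativeSemigroup (f zero) (g zero) _ _)

sumF-mono : ∀ {n} {f g : Fin n → ℕ} → (∀ i → f i ≤ g i) → sumF f ≤ sumF g
sumF-mono {zero}  f≤g = z≤n
sumF-mono {suc n} f≤g = +-mono-≤ (f≤g zero) (sumF-mono (f≤g ∘ suc))

sumF≡0 : ∀ {n} {f : Fin n → ℕ} → (∀ i → f i ≡ 0) → sumF f ≡ 0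
sumF≡0 {zero}  f≡0 = refl
sumF≡0 {suc n} f≡0 = cong₂ _+_ (f≡0 zero) (sumF≡0 (f≡0 ∘ suc))

term≤sumF : ∀ {n} (f : Fin n → ℕ) i → f i ≤ sumF f
term≤sumF f zero    = m≤m+n _ _
term≤sumF f (suc i) = ≤-trans (term≤sumF (f ∘ suc) i) (m≤n+m _ _)

sumF-pos⇒∃ : ∀ {n} (f : Fin n → ℕ) → 0 < sumF f → ∃ λ i → 0 < f i
sumF-pos⇒∃ {suc n} f pos with f zero in f0
... | suc _ = zero , subst (0 <_) (sym f0) (s≤s z≤n)
... | zero  = let (i , fi) = sumF-pos⇒∃ (f ∘ suc) pos in suc i , fi

term≤sumB : (f : Bool → ℕ) (b : Bool) → f b ≤ sumB f
term≤sumB f false = m≤m+n _ _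
term≤sumB f true  = m≤n+m _ _

sumB-pos⇒∃ : (f : Bool → ℕ) → 0 < sumB f → ∃ λ b → 0 < f b
sumB-pos⇒∃ f pos with f false in f0
... | suc _ = false , subst (0 <_) (sym f0) (s≤s z≤n)
... | zero  = true , pos

sumQ≡0 : ∀ {n} {f : Fin n → ℚ.ℚ} → (∀ i → f i ≡ 0ℚ) → sumQ f ≡ 0ℚ
sumQ≡0 {zero}  f≡0 = refl
sumQ≡0 {suc n} f≡0 = trans (cong₂ ℚ._+_ (f≡0 zero) (sumQ≡0 (f≡0 ∘ suc))) (ℚ.+-identityˡ 0ℚ)

restrict : ∀ {n} → (Fin n → Bool) → (Fin n → ℕ) → Fin n → ℕ
restrict p f i = if p i then f i else 0

sumOver : ∀ {n} → (Fin n → Bool) → (Fin n → ℕ) → ℕ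
sumOver p f = sumF (restrict p f)

count : ∀ {n} → (Fin n → Bool) → ℕ
count p = sumOver p (λ _ → 1)

module _ {n : ℕ} where

  sumOver-+ : ∀ (p : Fin n → Bool) {f g h : Fin n → ℕ} →
              (∀ i → p i ≡ true → f i ≡ g i + h i) → sumOver p f ≡ sumOver p g + sumOver p h
  sumOver-+ p {f} {g} {h} f≡g+h = trans (sumF-cong pointwise) (sumF-+ (restrict p g) (restrict p h))
    where
      pointwise : ∀ i → (if p i then f i else 0) ≡ (if p i then g i else 0) + (if p i then h i else 0)
      pointwise i with p i in pi
      ... | true  = f≡g+h i pi
      ... | false = refl

  sumOver-mono : ∀ (p : Fin n → Bool) {f g : Fin n → ℕ} →
                 (∀ i → p i ≡ true → f i ≤ g i) → sumOver p f ≤ sumOver p g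
  sumOver-mono p {f} {g} f≤g = sumF-mono pointwise
    where
      pointwise : ∀ i → (if p i then f i else 0) ≤ (if p i then g i else 0)
      pointwise i with p i in pi
      ... | true  = f≤g i pi
      ... | false = z≤n

  sumOver-⊆ : ∀ (p q : Fin n → Bool) {f : Fin n → ℕ} →
              (∀ i → p i ≡ true → q i ≡ true) → sumOver p f ≤ sumOver q f
  sumOver-⊆ p q {f} p⊆q = sumF-mono pointwise
    where
      pointwise : ∀ i → (if p i then f i else 0) ≤ (if q i then f i else 0)
      pointwise i with p i in pi
      ... | false = z≤n
      ... | true rewrite p⊆q i pi = ≤-refl

  sumOver-disjoint : ∀ (p q r : Fin n → Bool) {f : Fin n → ℕ} →
                     (∀ i → p i ≡ true → q i ≡ false) →
                     (∀ i → p i ≡ true → r i ≡ true) → (∀ i → q i ≡ true → r i ≡ true) →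
                     sumOver p f + sumOver q f ≤ sumOver r f
  sumOver-disjoint p q r {f} disjoint p⊆r q⊆r =
    subst (_≤ sumOver r f) (sumF-+ (restrict p f) (restrict q f)) (sumF-mono pointwise)
    where
      pointwise : ∀ i → (if p i then f i else 0) + (if q i then f i else 0) ≤ (if r i then f i else 0)
      pointwise i with p i in pi | q i in qi
      ... | true  | true  with () ← trans (sym qi) (disjoint i pi)
      ... | true  | false rewrite p⊆r i pi = ≤-reflexive (+-identityʳ (f i))
      ... | false | true  rewrite q⊆r i qi = ≤-refl
      ... | false | false = z≤n

  sumOver-partition : ∀ (p q r : Fin n → Bool) {f : Fin n → ℕ} →
                      (∀ i → p i ≡ true → q i ≡ true ⊎ r i ≡ true) →
                      (∀ i → q i ≡ true → r i ≡ false) →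
                      sumOver p f ≡ sumOver (λ i → p i ∧ q i) f + sumOver (λ i → p i ∧ r i) f
  sumOver-partition p q r {f} covered disjoint =
    trans (sumF-cong pointwise) (sumF-+ (restrict (λ i → p i ∧ q i) f) (restrict (λ i → p i ∧ r i) f))
    where
      pointwise : ∀ i → (if p i then f i else 0)
                      ≡ (if p i ∧ q i then f i else 0) + (if p i ∧ r i then f i else 0)
      pointwise i with p i in pi | q i in qi | r i in ri
      ... | false | _     | _     = refl
      ... | true  | true  | false = sym (+-identityʳ (f i))
      ... | true  | false | true  = refl
      ... | true  | true  | true  with () ← trans (sym ri) (disjoint i qi)
      ... | true  | false | false with covered i pi
      ...   | inj₁ qi′ with () ← trans (sym qi) qi′
      ...   | inj₂ ri′ with () ← trans (sym ri) ri′

sumOver-head : ∀ {n} (p : Fin (suc n) → Bool) {f : Fin (suc n) → ℕ} →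
               (∀ i → p (suc i) ≡ false) → sumOver p f ≡ (if p zero then f zero else 0)
sumOver-head p {f} tail-false =
  trans (cong ((if p zero then f zero else 0) +_) (sumF≡0 tail≡0)) (+-identityʳ _)
  where
    tail≡0 : ∀ i → (if p (suc i) then f (suc i) else 0) ≡ 0
    tail≡0 i rewrite tail-false i = refl

sumOver≡sum∘filter : ∀ {n} (p : Fin n → Bool) (f : Fin n → ℕ) →
                     sumOver p f ≡ sum (map f (filterᵇ p (allFin n)))
sumOver≡sum∘filter p f = over-tabulate id
  where
    over-tabulate : ∀ {k} (h : Fin k → Fin _) →
                    sumF (restrict p f ∘ h) ≡ sum (map f (filterᵇ p (tabulate h)))
    over-tabulate {zero}  h = refl
    over-tabulate {suc k} h with p (h zero)
    ... | true  = cong (f (h zero) +_) (over-tabulate (h ∘ suc))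
    ... | false = over-tabulate (h ∘ suc)

count≡0⇒none : ∀ {n} {p : Fin n → Bool} → count p ≡ 0 → ∀ i → p i ≡ false
count≡0⇒none {suc n} {p} none i with p zero in p0
count≡0⇒none {suc n} {p} none zero    | false = p0
count≡0⇒none {suc n} {p} none (suc i) | false = count≡0⇒none none i

count≡1⇒unique : ∀ {n} {p : Fin n → Bool} → count p ≡ 1 →
                 ∃ λ a → p a ≡ true × (∀ i → p i ≡ true → i ≡ a)
count≡1⇒unique {suc n} {p} one with p zero in p0
... | true  = zero , p0 , only-zero
  where
    only-zero : ∀ i → p i ≡ true → i ≡ zero
    only-zero zero    _  = refl
    only-zero (suc i) pi with () ← trans (sym pi) (count≡0⇒none (cong ℕ.pred one) i)
... | false =
  let (a , pa , unique) = count≡1⇒unique one in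
  suc a , pa , λ where
    zero    p0′ → ⊥-elim (false≢true (trans (sym p0) p0′))
    (suc i) pi  → cong suc (unique i pi)

count≡2⇒pair : ∀ {n} {p : Fin n → Bool} → count p ≡ 2 →
               ∃₂ λ a c → a ≢ c × p a ≡ true × p c ≡ true × (∀ i → p i ≡ true → i ≡ a ⊎ i ≡ c)
count≡2⇒pair {suc n} {p} two with p zero in p0
... | true  =
  let (c , pc , unique) = count≡1⇒unique (cong ℕ.pred two) in
  zero , suc c , (λ ()) , p0 , pc , λ where
    zero    _  → inj₁ refl
    (suc i) pi → inj₂ (cong suc (unique i pi))
... | false =
  let (a , c , a≢c , pa , pc , pair) = count≡2⇒pair two in
  suc a , suc c , a≢c ∘ suc-injective , pa , pc , λ where
    zero    p0′ → ⊥-elim (false≢true (trans (sym p0) p0′))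
    (suc i) pi  → Sum.map (cong suc) (cong suc) (pair i pi)

module _ {m m′ : ℕ} {G : Graph m} {H : Graph m′} (π : Cover G H) where

  legsOver : Fin m′ → Fin m → Bool
  legsOver l′ l = eqF (πL π l) l′

  legsAtOver : Fin (nV G) → Fin m′ → Fin m → Bool
  legsAtOver W l′ l = eqF (legAt G l) W ∧ legsOver l′ l

  legCount : Fin (nV G) → Fin m′ → ℕ
  legCount W l′ = count (legsAtOver W l′)

  excess : Fin (nV G) → Fin m′ → ℕ
  excess W l′ = sumOver (legsAtOver W l′) (λ l → dL π l ∸ 1)

  dV≡sumOver-legsAtOver : ∀ {W l′} → πV π W ≡ legAt H l′ → dV π W ≡ sumOver (legsAtOver W l′) (dL π)
  dV≡sumOver-legsAtOver {W} {l′} over = harm-L π W l′ (sym over)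

  dL∈legProfile : ∀ {l′ l} → legsOver l′ l ≡ true → dL π l ∈ legProfile π l′
  dL∈legProfile {l′} {l} over =
    ∈-map⁺ (dL π) (∈-filter⁺ (Bool.T? ∘ legsOver l′) (∈-allFin l) (subst T (sym over) _))

module SimpleBranch {m m′ : ℕ} {G : Graph m} {H : Graph m′} (π : Cover G H) {l′ : Fin m′} {k : ℕ}
                    (profile : legProfile π l′ ↭ 2 ∷ replicate k 1) where

  dL-over∈[1,2] : ∀ {l} → legsOver π l′ l ≡ true → 1 ≤ dL π l × dL π l ≤ 2
  dL-over∈[1,2] over = lookup bounds (∈-resp-↭ profile (dL∈legProfile π over))
    where
      bounds : All (λ d → 1 ≤ d × d ≤ 2) (2 ∷ replicate k 1)
      bounds = (s≤s z≤n , ≤-refl) ∷ replicate⁺ k (≤-refl , s≤s z≤n)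

  total-excess : sumOver (legsOver π l′) (λ l → dL π l ∸ 1) ≡ 1
  total-excess = begin
    sumOver (legsOver π l′) (λ l → dL π l ∸ 1)
      ≡⟨ sumOver≡sum∘filter (legsOver π l′) _ ⟩
    sum (map ((_∸ 1) ∘ dL π) (filterᵇ (legsOver π l′) (allFin m)))
      ≡⟨ cong sum (map-∘ (filterᵇ (legsOver π l′) (allFin m))) ⟩
    sum (map (_∸ 1) (legProfile π l′))
      ≡⟨ sum-↭ (map⁺ (_∸ 1) profile) ⟩
    suc (sum (map (_∸ 1) (replicate k 1)))
      ≡⟨ cong suc (no-excess k) ⟩
    1 ∎
    where
      open ≡-Reasoning
      no-excess : ∀ k → sum (map (_∸ 1) (replicate k 1)) ≡ 0
      no-excess zero    = refl
      no-excess (suc k) = no-excess k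

  dV≡legCount+excess : ∀ {W} → πV π W ≡ legAt H l′ → dV π W ≡ legCount π W l′ + excess π W l′
  dV≡legCount+excess over = trans (dV≡sumOver-legsAtOver π over)
    (sumOver-+ (legsAtOver π _ l′) λ l at → sym (m+[n∸m]≡n (proj₁ (dL-over∈[1,2] (proj₂ (∧-true at))))))

  excess≤legCount : ∀ W → excess π W l′ ≤ legCount π W l′
  excess≤legCount W = sumOver-mono (legsAtOver π W l′) λ l at →
    ∸-monoˡ-≤ 1 (proj₂ (dL-over∈[1,2] (proj₂ (∧-true at))))

  excess≤1 : ∀ W → excess π W l′ ≤ 1
  excess≤1 W = subst (excess π W l′ ≤_) total-excess
    (sumOver-⊆ (legsAtOver π W l′) (legsOver π l′) λ l at → proj₂ (∧-true at))

  excess+excess≤1 : ∀ {W W′} → W ≢ W′ → excess π W l′ + excess π W′ l′ ≤ 1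
  excess+excess≤1 {W} {W′} W≢W′ = subst (excess π W l′ + excess π W′ l′ ≤_) total-excess
    (sumOver-disjoint (legsAtOver π W l′) (legsAtOver π W′ l′) (legsOver π l′)
                      disjoint (λ l → proj₂ ∘ ∧-true) (λ l → proj₂ ∘ ∧-true))
    where
      disjoint : ∀ l → legsAtOver π W l′ l ≡ true → legsAtOver π W′ l′ l ≡ false
      disjoint l at = cong (_∧ legsOver π l′ l)
        (≢⇒eqF (W≢W′ ∘ trans (sym (eqF⇒≡ {i = legAt G l} (proj₁ (∧-true at))))))

  excess-elsewhere : ∀ {W W′} → W ≢ W′ → excess π W l′ ≡ 1 → excess π W′ l′ ≡ 0
  excess-elsewhere {W} {W′} W≢W′ excess≡1 =
    n<1⇒n≡0 (subst (λ e → e + excess π W′ l′ ≤ 1) excess≡1 (excess+excess≤1 W≢W′))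

module _ {m m′ : ℕ} {G : Graph m} {H : Graph m′} (π : Cover G H)
         (top : TopDimension H) (val≥3 : ∀ W → 3 ≤ val G W) where

  val≡2+dV : ∀ W → val G W ≡ 2 + dV π W
  val≡2+dV W with val G W | val≥3 W | riemann-hurwitz π W
  ... | suc zero    | s≤s () | _
  ... | suc (suc w) | _      | hurwitz =
    cong (2 +_) (ℤ.+-injective (trans hurwitz′ (ℤ.*-identityʳ (ℤ.+ dV π W))))
    where
      hurwitz′ : ℤ.+ w ≡ ℤ.+ dV π W ℤ.* ℤ.+ 1
      hurwitz′ = trans hurwitz (cong (λ v → ℤ.+ dV π W ℤ.* (ℤ.+ v ℤ.- ℤ.+ 2)) (top (πV π W)))

  dV-pos : ∀ W → 0 < dV π W
  dV-pos W = ≤-pred (≤-pred (subst (3 ≤_) (val≡2+dV W) (val≥3 W)))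

  edgeval-pos : ∀ W {e′ b′} → ends H e′ b′ ≡ πV π W → 0 < edgeval G W
  edgeval-pos W {e′} {b′} end =
    let (e , pos-e) = sumF-pos⇒∃ (λ e → sumB (degreeOver e))
                                  (subst (0 <_) (harm-E π W e′ b′ end) (dV-pos W))
        (b , pos-b) = sumB-pos⇒∃ (degreeOver e) pos-e
        at-W        = proj₁ (∧-true (if-pos⇒true pos-b))
    in ≤-trans (subst (λ x → 1 ≤ ind x) (sym at-W) ≤-refl)
               (≤-trans (term≤sumB (endAtW e) b) (term≤sumF (λ e → sumB (endAtW e)) e))
    where
      degreeOver endAtW : Fin (nE G) → Bool → ℕ
      degreeOver e b =
        if eqF (ends G e b) W ∧ eqF (πE π e) e′ ∧ eqB (b xor flip π e) b′ then dE π e else 0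
      endAtW e b = ind (eqF (ends G e b) W)

edgeEnd : ∀ {m} (H : Graph m) {V} → val H V ≡ 3 → legval H V ≡ 2 → ∃₂ λ e b → ends H e b ≡ V
edgeEnd H {V} val≡3 two-legs =
  let edgeval≡1   = +-cancelʳ-≡ 2 (edgeval H V) 1 (trans (cong (edgeval H V +_) (sym two-legs)) val≡3)
      (e , pos-e) = sumF-pos⇒∃ (λ e → sumB (λ b → ind (eqF (ends H e b) V)))
                                (subst (0 <_) (sym edgeval≡1) (s≤s z≤n))
      (b , pos-b) = sumB-pos⇒∃ (λ b → ind (eqF (ends H e b) V)) pos-e
  in e , b , eqF⇒≡ (if-pos⇒true pos-b)

twoLegsAt : ∀ {m} (H : Graph m) {V} → legval H V ≡ 2 →
            ∃₂ λ a c → a ≢ c × legAt H a ≡ V × legAt H c ≡ V × (∀ l → legAt H l ≡ V → l ≡ a ⊎ l ≡ c)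
twoLegsAt H two-legs =
  let (a , c , a≢c , a-at , c-at , pair) = count≡2⇒pair two-legs in
  a , c , a≢c , eqF⇒≡ a-at , eqF⇒≡ c-at , λ l at → pair l (≡⇒eqF at)

zeroColumn⇒¬Invertible : ∀ {r c} (A : Mat r c) (j : Fin c) → (∀ i → A i j ≡ 0ℚ) → ¬ Invertible A
zeroColumn⇒¬Invertible A j column≡0 (B , _ , BA≡id) = 0≢1 (begin
  0ℚ          ≡⟨ sym (sumQ≡0 λ t → trans (cong (B j t ℚ.*_) (column≡0 t)) (ℚ.*-zeroʳ (B j t))) ⟩
  (B ⊗ A) j j ≡⟨ BA≡id j j ⟩
  idMat j j   ≡⟨ cong (λ b → if b then 1ℚ else 0ℚ) (≡⇒eqF {i = j} refl) ⟩
  1ℚ          ∎)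
  where
    open ≡-Reasoning
    0≢1 : 0ℚ ≢ 1ℚ
    0≢1 ()

module _ {m m′ : ℕ} {G : Graph m} {H : Graph m′} (π : Cover G H) (S : Stabilization G) where

  ftF-column≡0 : ∀ e′ → (∀ s → πE π s ≡ e′ → core G s ≡ false) → ∀ t → (ftMat G S ⊗ Fmat π) t e′ ≡ 0ℚ
  ftF-column≡0 e′ no-core t = sumQ≡0 term≡0
    where
      term≡0 : ∀ s → ftMat G S t s ℚ.* Fmat π s e′ ≡ 0ℚ
      term≡0 s with πE π s ≟ e′
      ... | yes over rewrite cls-non S s (no-core s over) =
        ℚ.*-zeroˡ (frac (foldr lcm 1 (edgeProfile π e′)) (dE π s))
      ... | no _ = ℚ.*-zeroʳ (ftMat G S t s)

  invertible⇒coreEdgeOver : Invertible (ftMat G S ⊗ Fmat π) →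
                            ∀ e′ → ∃ λ s → πE π s ≡ e′ × core G s ≡ true
  invertible⇒coreEdgeOver inv e′ with any? (λ s → (πE π s ≟ e′) ×-dec (core G s Bool.≟ true))
  ... | yes found = found
  ... | no none   = ⊥-elim (zeroColumn⇒¬Invertible _ e′ (ftF-column≡0 e′ no-core) inv)
    where
      no-core : ∀ s → πE π s ≡ e′ → core G s ≡ false
      no-core s over = ¬-not λ core≡true → none (s , over , core≡true)

module _ {m : ℕ} (G : Graph m) where

  iter-⊆ : ∀ k {alive e} → iter G k alive e ≡ true → alive e ≡ true
  iter-⊆ zero    survives = survives
  iter-⊆ (suc k) survives = proj₁ (∧-true (iter-⊆ k survives))

  iter-pruned : ∀ k {alive e} → Fin k → iter G k alive e ≡ true → pruneStep G alive e ≡ true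
  iter-pruned (suc k) _ = iter-⊆ k

  core⇒edgeval≢1 : ∀ {s} → core G s ≡ true → ∀ b → edgeval G (ends G s b) ≢ 1
  core⇒edgeval≢1 {s} in-core b = not-isOne (end b (iter-pruned (nE G) s in-core))
    where
      not-isOne : ∀ {n} → not (isOne G n) ≡ true → n ≢ 1
      not-isOne () refl
      end : ∀ b → pruneStep G (λ _ → true) s ≡ true → not (isOne G (edgeval G (ends G s b))) ≡ true
      end false = proj₁ ∘ ∧-true
      end true  = proj₂ ∘ ∧-true

0<m+n⇒n≤m⇒0<m : ∀ {m n} → 0 < m + n → n ≤ m → 0 < m
0<m+n⇒n≤m⇒0<m {zero}  () z≤n
0<m+n⇒n≤m⇒0<m {suc m} _  _ = s≤s z≤n

m≤1⇒n≤1⇒2≤m+n⇒≡1 : ∀ {m n} → m ≤ 1 → n ≤ 1 → 2 ≤ m + n → m ≡ 1 × n ≡ 1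
m≤1⇒n≤1⇒2≤m+n⇒≡1 (s≤s z≤n) (s≤s z≤n) _         = refl , refl
m≤1⇒n≤1⇒2≤m+n⇒≡1 z≤n       (s≤s z≤n) (s≤s ())
m≤1⇒n≤1⇒2≤m+n⇒≡1 (s≤s z≤n) z≤n       (s≤s ())
m≤1⇒n≤1⇒2≤m+n⇒≡1 z≤n       z≤n       ()

-- ev, d, n, e: edge valency, local degree, legCount and excess at a vertex over V.
ramifiedVertex : ∀ {ev d nₐ n꜀ eₐ e꜀} → ev + (nₐ + n꜀) ≡ 2 + d → 2 ≤ ev →
                 d ≡ nₐ + eₐ → d ≡ n꜀ + e꜀ → eₐ ≤ nₐ → e꜀ ≤ n꜀ → eₐ ≤ 1 → e꜀ ≤ 1 → 0 < d →
                 d ≡ 2 × eₐ ≡ 1 × e꜀ ≡ 1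
ramifiedVertex {ev} {d} {nₐ} {n꜀} {eₐ} {e꜀} balance 2≤ev dₐ d꜀ eₐ≤nₐ e꜀≤n꜀ eₐ≤1 e꜀≤1 0<d =
  ≤-antisym d≤2 2≤d , m≤1⇒n≤1⇒2≤m+n⇒≡1 eₐ≤1 e꜀≤1 (≤-trans 2≤d d≤eₐ+e꜀)
  where
    open ≤-Reasoning
    nₐ+n꜀≤d : nₐ + n꜀ ≤ d
    nₐ+n꜀≤d = +-cancelˡ-≤ 2 _ _ (≤-trans (+-monoˡ-≤ (nₐ + n꜀) 2≤ev) (≤-reflexive balance))
    d≤eₐ+e꜀ : d ≤ eₐ + e꜀
    d≤eₐ+e꜀ = +-cancelˡ-≤ d _ _ (begin
      d + d                 ≡⟨ cong₂ _+_ dₐ d꜀ ⟩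
      (nₐ + eₐ) + (n꜀ + e꜀) ≡⟨ interchange +-commutativeSemigroup nₐ eₐ n꜀ e꜀ ⟩
      (nₐ + n꜀) + (eₐ + e꜀) ≤⟨ +-monoˡ-≤ (eₐ + e꜀) nₐ+n꜀≤d ⟩
      d + (eₐ + e꜀)         ∎)
    2≤d : 2 ≤ d
    2≤d = ≤-trans (+-mono-≤ (0<m+n⇒n≤m⇒0<m (subst (0 <_) dₐ 0<d) eₐ≤nₐ)
                            (0<m+n⇒n≤m⇒0<m (subst (0 <_) d꜀ 0<d) e꜀≤n꜀))
                  nₐ+n꜀≤d
    d≤2 : d ≤ 2
    d≤2 = ≤-trans d≤eₐ+e꜀ (+-mono-≤ eₐ≤1 e꜀≤1)

unramifiedVertex : ∀ {ev d nₐ n꜀} → ev + (nₐ + n꜀) ≡ 2 + d → d ≡ nₐ → d ≡ n꜀ → 0 < ev → 0 < d → d ≡ 1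
unramifiedVertex {ev} {d} balance refl refl 0<ev 0<d =
  ≤-antisym (+-cancelʳ-≤ d d 1 (≤-pred (≤-trans (+-monoˡ-≤ (d + d) 0<ev) (≤-reflexive balance)))) 0<d

block-suc≢0 : ∀ {g} → 2 ≤ g → ∀ j → block g (suc j) ≢ 0
block-suc≢0 (s≤s (s≤s z≤n)) j ()

module _ {g : ℕ} {G : Graph (nLegs g)} {H : Graph (3 * g)} (π : Cover G H)
         (top : TopDimension H) (val≥3 : ∀ W → 3 ≤ val G W) (2≤g : 2 ≤ g)
         (labelled : ∀ l → toℕ (πL π l) ≡ block g (toℕ l)) (degree : HasDegree π g)
         {x : Fin (3 * g)} (x≡ℓ₁ : toℕ x ≡ 0) {V : Fin (nV H)} (x-at-V : legAt H x ≡ V) where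

  ℓ₁-over : legsOver π x zero ≡ true
  ℓ₁-over = ≡⇒eqF (toℕ-injective (trans (labelled zero) (sym x≡ℓ₁)))

  only-ℓ₁-over : ∀ i → legsOver π x (suc i) ≡ false
  only-ℓ₁-over i = ≢⇒eqF λ over →
    block-suc≢0 2≤g (toℕ i) (trans (sym (labelled (suc i))) (trans (cong toℕ over) x≡ℓ₁))

  dV-over-ℓ₁ : ∀ {W} → πV π W ≡ V → dV π W ≡ (if legsAtOver π W x zero then dL π zero else 0)
  dV-over-ℓ₁ {W} over = trans (dV≡sumOver-legsAtOver π (trans over (sym x-at-V)))
    (sumOver-head (legsAtOver π W x) {dL π} λ i →
      trans (cong (eqF (legAt G (suc i)) W ∧_) (only-ℓ₁-over i)) (∧-zeroʳ _))

  fibreOverℓ₁ : Σ (Fin (nV G)) λ W → πV π W ≡ V × (∀ W′ → πV π W′ ≡ V → W′ ≡ W) × dV π W ≡ g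
  fibreOverℓ₁ = legAt G zero , over , unique , dV≡g
    where
      over : πV π (legAt G zero) ≡ V
      over = trans (sym (inc-L π zero)) (trans (cong (legAt H) (eqF⇒≡ ℓ₁-over)) x-at-V)
      unique : ∀ W′ → πV π W′ ≡ V → W′ ≡ legAt G zero
      unique W′ over′ = sym (eqF⇒≡ (proj₁ (∧-true
        (if-pos⇒true (subst (0 <_) (dV-over-ℓ₁ over′) (dV-pos π top val≥3 W′))))))
      dV≡g : dV π (legAt G zero) ≡ g
      dV≡g = begin
        dV π (legAt G zero)
          ≡⟨ dV-over-ℓ₁ over ⟩
        (if legsAtOver π (legAt G zero) x zero then dL π zero else 0)
          ≡⟨ cong (λ b → if b then dL π zero else 0) (cong₂ _∧_ (≡⇒eqF {i = legAt G zero} refl) ℓ₁-over) ⟩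
        dL π zero
          ≡⟨ cong (λ b → if b then dL π zero else 0) ℓ₁-over ⟨
        (if legsOver π x zero then dL π zero else 0)
          ≡⟨ sumOver-head (legsOver π x) {dL π} only-ℓ₁-over ⟨
        sumOver (legsOver π x) (dL π)
          ≡⟨ proj₂ degree x ⟩
        g ∎
        where open ≡-Reasoning

module TwoLeggedVertex {m m′ : ℕ} {G : Graph m} {H : Graph m′} (π : Cover G H)
  (top : TopDimension H) (val≥3 : ∀ W → 3 ≤ val G W)
  {V : Fin (nV H)} {a c : Fin m′} (a≢c : a ≢ c) (a-at-V : legAt H a ≡ V) (c-at-V : legAt H c ≡ V)
  (legsAtV : ∀ l′ → legAt H l′ ≡ V → l′ ≡ a ⊎ l′ ≡ c)
  {k : ℕ} (profile-a : legProfile π a ↭ 2 ∷ replicate k 1)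
          (profile-c : legProfile π c ↭ 2 ∷ replicate k 1)
  where

  module A = SimpleBranch π profile-a
  module C = SimpleBranch π profile-c

  legval≡legCounts : ∀ {W} → πV π W ≡ V → legval G W ≡ legCount π W a + legCount π W c
  legval≡legCounts {W} over =
    sumOver-partition (λ l → eqF (legAt G l) W) (legsOver π a) (legsOver π c) over-a-or-c disjoint
    where
      over-a-or-c : ∀ l → eqF (legAt G l) W ≡ true → legsOver π a l ≡ true ⊎ legsOver π c l ≡ true
      over-a-or-c l at = Sum.map ≡⇒eqF ≡⇒eqF
        (legsAtV (πL π l) (trans (inc-L π l) (trans (cong (πV π) (eqF⇒≡ at)) over)))
      disjoint : ∀ l → legsOver π a l ≡ true → legsOver π c l ≡ false
      disjoint l over-a = ≢⇒eqF λ over-c → a≢c (trans (sym (eqF⇒≡ {i = πL π l} over-a)) over-c)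

  valency-balance : ∀ {W} → πV π W ≡ V →
                    edgeval G W + (legCount π W a + legCount π W c) ≡ 2 + dV π W
  valency-balance {W} over =
    trans (cong (edgeval G W +_) (sym (legval≡legCounts over))) (val≡2+dV π top val≥3 W)

  ramified : ∀ {W} → πV π W ≡ V → 2 ≤ edgeval G W →
             dV π W ≡ 2 × excess π W a ≡ 1 × excess π W c ≡ 1
  ramified {W} over 2≤ev =
    ramifiedVertex (valency-balance over) 2≤ev
      (A.dV≡legCount+excess (trans over (sym a-at-V))) (C.dV≡legCount+excess (trans over (sym c-at-V)))
      (A.excess≤legCount W) (C.excess≤legCount W) (A.excess≤1 W) (C.excess≤1 W)
      (dV-pos π top val≥3 W)

  unramified : ∀ {e′ b′} → ends H e′ b′ ≡ V → ∀ {W} → excess π W a ≡ 1 → excess π W c ≡ 1 →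
               ∀ W′ → πV π W′ ≡ V → W′ ≢ W → dV π W′ ≡ 1
  unramified end {W} eₐ≡1 e꜀≡1 W′ over′ W′≢W =
    unramifiedVertex (valency-balance over′)
      (dV≡legCount (A.dV≡legCount+excess (trans over′ (sym a-at-V)))
                   (A.excess-elsewhere (≢-sym W′≢W) eₐ≡1))
      (dV≡legCount (C.dV≡legCount+excess (trans over′ (sym c-at-V)))
                   (C.excess-elsewhere (≢-sym W′≢W) e꜀≡1))
      (edgeval-pos π top val≥3 W′ (trans end (sym over′))) (dV-pos π top val≥3 W′)
    where
      dV≡legCount : ∀ {d n e} → d ≡ n + e → e ≡ 0 → d ≡ n
      dV≡legCount d≡n+e refl = trans d≡n+e (+-identityʳ _)

  fibreAtSimpleBranches : (S : Stabilization G) → Invertible (ftMat G S ⊗ Fmat π) →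
    ∀ {e′ b′} → ends H e′ b′ ≡ V →
    Σ (Fin (nV G)) λ W → πV π W ≡ V × dV π W ≡ 2 × (∀ W′ → πV π W′ ≡ V → W′ ≢ W → dV π W′ ≡ 1)
  fibreAtSimpleBranches S inv {e′} {b′} end with invertible⇒coreEdgeOver π S inv e′
  ... | s , s-over , s-core =
    let (d≡2 , eₐ≡1 , e꜀≡1) = ramified over 2≤ev in
    W , over , d≡2 , unramified end eₐ≡1 e꜀≡1
    where
      W : Fin (nV G)
      W = ends G s (b′ xor flip π s)
      over : πV π W ≡ V
      over = begin
        πV π W                                           ≡⟨ inc-E π s (b′ xor flip π s) ⟨
        ends H (πE π s) ((b′ xor flip π s) xor flip π s) ≡⟨ cong₂ (ends H) s-over (xor-cancelʳ b′ (flip π s)) ⟩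
        ends H e′ b′                                     ≡⟨ end ⟩
        V                                                ∎
        where
          open ≡-Reasoning
          xor-cancelʳ : ∀ x y → (x xor y) xor y ≡ x
          xor-cancelʳ x y =
            trans (xor-assoc x y y) (trans (cong (x xor_) (xor-same y)) (xor-identityʳ x))
      2≤ev : 2 ≤ edgeval G W
      2≤ev = ≤∧≢⇒< (edgeval-pos π top val≥3 W (trans end (sym over)))
                   (≢-sym (core⇒edgeval≢1 G s-core _))

mainTheorem12 : (g : ℕ) → 2 ≤ g →
    (G : Graph (nLegs g)) (H : Graph (3 * g)) (π : Cover G H) →
    InAC g π → TopDimension H →
    (S : Stabilization G) → Invertible (ftMat G S ⊗ Fmat π) →
    (V : Fin (nV H)) → legval H V ≡ 2 →
      ( (Σ (Fin (nV G)) λ W → (πV π W ≡ V) × (∀ W' → πV π W' ≡ V → W' ≡ W)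
                              × (dV π W ≡ g))
        × (∃ λ l → (legAt H l ≡ V) × (toℕ l ≡ 0)) )
    ⊎ ( (Σ (Fin (nV G)) λ Vh → (πV π Vh ≡ V) × (dV π Vh ≡ 2)
                               × (∀ W → πV π W ≡ V → W ≢ Vh → dV π W ≡ 1))
        × (∀ l → legAt H l ≡ V → legProfile π l ↭ (2 ∷ replicate (g ∸ 2) 1)) )
mainTheorem12 g 2≤g G H π (_ , (_ , _ , val≥3) , degree , labelled , _ , simple)
              top S inv V two-legs with twoLegsAt H two-legs
... | a , c , a≢c , a-at-V , c-at-V , legsAtV with toℕ a ℕ.≟ 0 | toℕ c ℕ.≟ 0
...   | yes a≡ℓ₁ | _        =
  inj₁ (fibreOverℓ₁ π top val≥3 2≤g labelled degree a≡ℓ₁ a-at-V , a , a-at-V , a≡ℓ₁)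
...   | no _     | yes c≡ℓ₁ =
  inj₁ (fibreOverℓ₁ π top val≥3 2≤g labelled degree c≡ℓ₁ c-at-V , c , c-at-V , c≡ℓ₁)
...   | no a≢ℓ₁  | no c≢ℓ₁  =
  let (e′ , b′ , end) = edgeEnd H (top V) two-legs in
  inj₂ (TwoLeggedVertex.fibreAtSimpleBranches π top val≥3 a≢c a-at-V c-at-V legsAtV
          (simple a a≢ℓ₁) (simple c c≢ℓ₁) S inv end , profile)
  where
    profile : ∀ l → legAt H l ≡ V → legProfile π l ↭ (2 ∷ replicate (g ∸ 2) 1)
    profile l at with legsAtV l at
    ... | inj₁ refl = simple a a≢ℓ₁
    ... | inj₂ refl = simple c c≢ℓ₁
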